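{- Let $r,r'$ be roots of a $\lambda$-graph $G$. Then $[\![r]\!]=[\![r']\!]$ holds if and only if, for every trace $\tau$: (1) there is a path $r\xrightarrow{\tau}$ if and only if there is a path $r'\xrightarrow{\tau}$; and (2) if both $r\xrightarrow{\tau}$ and $r'\xrightarrow{\tau}$ exist, then $[\![r\xrightarrow{\tau}]\!]=[\![r'\xrightarrow{\tau}]\!]$.
   Context: A $\lambda$-graph: finite directed graph with application nodes $\mathrm{App}(n_1,n_2)$ (left child $n_1$, direction $\swarrow$; right child $n_2$, direction $\searrow$), abstraction nodes $\mathrm{Abs}(n)$ (child $n$, direction $\downarrow$), free variable nodes (no children; each carries an atom $\mathrm{id}(n)$, distinct nodes distinct atoms), bound variable nodes $\mathrm{Var}(l)$ with a binding edge to an abstraction node $l$. Traces are finite sequences of directions; $d\cdot\tau$ is $\tau$ followed by $d$. Paths: $n\xrightarrow{\epsilon}n$; if $n\xrightarrow{\tau}\mathrm{Abs}(m)$ then $n\xrightarrow{\downarrow\cdot\tau}m$; if $n\xrightarrow{\tau}\mathrm{App}(m_1,m_2)$ then $n\xrightarrow{\swarrow\cdot\tau}m_1$ and $n\xrightarrow{\searrow\cdot\tau}m_2$. A root is a node $r$ whose only incoming path has empty trace. A path crosses $m$ if it ends at $m$ or is an extension of a path crossing $m$. The graph is acyclic (paths from a node to itself have empty trace) and every path from a root to $\mathrm{Var}(l)$ crosses $l$. Locally nameless terms: $t::=\underline k\mid x\mid t\,t\mid\lambda t$ ($k\in\mathbb N$, $x$ an atom). For a path crossing an abstraction node $l$: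 $\mathrm{idx}_l(n\xrightarrow{\tau}l)=0$; $\mathrm{idx}_l(n\xrightarrow{d\cdot\tau}l')=\mathrm{idx}_l(n\xrightarrow{\tau})+1$ if $l'\neq l$ is an abstraction node; $\mathrm{idx}_l(n\xrightarrow{d\cdot\tau}m)=\mathrm{idx}_l(n\xrightarrow{\tau})$ otherwise. Readback from a root $r$: $[\![r\xrightarrow{\tau}\mathrm{Var}(l)]\!]=\underline{\mathrm{idx}_l(r\xrightarrow{\tau})}$; $[\![r\xrightarrow{\tau}n]\!]=\mathrm{id}(n)$ for free variable $n$; $[\![r\xrightarrow{\tau}\mathrm{Abs}(m)]\!]=\lambda[\![r\xrightarrow{\downarrow\cdot\tau}m]\!]$; $[\![r\xrightarrow{\tau}\mathrm{App}(n_1,n_2)]\!]=[\![r\xrightarrow{\swarrow\cdot\tau}n_1]\!]\,[\![r\xrightarrow{\searrow\cdot\tau}n_2]\!]$; $[\![r]\!]=[\![r\xrightarrow{\epsilon}r]\!]$. -}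

module Defs where

open import Data.Nat using (ℕ; zero; suc)
open import Data.Fin using (Fin)
open import Data.List using (List; []; _∷_)
open import Data.Product using (Σ; ∃; _×_; _,_)
open import Relation.Binary.PropositionalEquality using (_≡_; _≢_)
open import Relation.Nullary using (¬_)

-- Directions: ↙ (left child of App), ↘ (right child of App), ↓ (child of Abs)
data Dir : Set where
  ↙ ↘ ↓ : Dir

-- Traces. The paper's  d·τ  ("τ followed by d") is  d ∷ τ  here:
-- the most recent direction is at the head of the list.
Trace : Set
Trace = List Dir

data Label (N : ℕ) (A : Set) : Set where
  app : Fin N → Fin N → Label N A
  abs : Fin N → Label N A
  fv  : A → Label N A
  var : Fin N → Label N A           -- Var(l), binding edge to l

-- Locally nameless terms over atoms A
data Term (A : Set) : Set where
  bvar : ℕ → Term A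
  fvar : A → Term A
  _·_  : Term A → Term A → Term A
  ƛ    : Term A → Term A

record Graph (A : Set) : Set where
  constructor mkGraph
  field
    N     : ℕ
    label : Fin N → Label N A

module _ {A : Set} (G : Graph A) where
  open Graph G

  Node : Set
  Node = Fin N

  IsAbs : Node → Set
  IsAbs l = ∃ λ m → label l ≡ abs m

  data Path (n : Node) : Trace → Node → Set where
    ε    : Path n [] n
    step↓ : ∀ {τ m k} → Path n τ m → label m ≡ abs k → Path n (↓ ∷ τ) k
    step↙ : ∀ {τ m k₁ k₂} → Path n τ m → label m ≡ app k₁ k₂ → Path n (↙ ∷ τ) k₁
    step↘ : ∀ {τ m k₁ k₂} → Path n τ m → label m ≡ app k₁ k₂ → Path n (↘ ∷ τ) k₂

  HasPath : Node → Trace → Set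
  HasPath n τ = ∃ λ m → Path n τ m

  IsRoot : Node → Set
  IsRoot r = ∀ n τ → Path n τ r → τ ≡ []

  -- The path n --τ--> crosses m (paths are determined by start node and trace)
  data Crosses (n : Node) : Trace → Node → Set where
    ends   : ∀ {τ m} → Path n τ m → Crosses n τ m
    extend : ∀ {τ d k m} → Crosses n τ m → Path n (d ∷ τ) k → Crosses n (d ∷ τ) m

  record IsLambdaGraph : Set where
    field
      var-abs    : ∀ n l → label n ≡ var l → IsAbs l
      fv-injective : ∀ n n' a → label n ≡ fv a → label n' ≡ fv a → n ≡ n'
      acyclic    : ∀ n τ → Path n τ n → τ ≡ []
      var-bound  : ∀ r τ n l → IsRoot r → Path r τ n → label n ≡ var l → Crosses r τ l

  -- Idx l n τ k :  idx_l(n --τ-->) = k  (for a path crossing l)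
  data Idx (l : Node) (n : Node) : Trace → ℕ → Set where
    idx-here  : ∀ {τ} → Path n τ l → Idx l n τ 0
    idx-abs   : ∀ {τ d l' k} → Path n (d ∷ τ) l' → l' ≢ l → IsAbs l' →
                Idx l n τ k → Idx l n (d ∷ τ) (suc k)
    idx-other : ∀ {τ d m k} → Path n (d ∷ τ) m → m ≢ l → ¬ IsAbs m →
                Idx l n τ k → Idx l n (d ∷ τ) k

  -- Read r τ n t :  ⟦ r --τ--> n ⟧ = t   (readback, as the graph of the
  -- recursively defined function)
  data Read (r : Node) : Trace → Node → Term A → Set where
    rd-var : ∀ {τ n l k} → Path r τ n → label n ≡ var l → Idx l r τ k →
             Read r τ n (bvar k)
    rd-fv  : ∀ {τ n a} → Path r τ n → label n ≡ fv a → Read r τ n (fvar a)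
    rd-abs : ∀ {τ n m t} → Path r τ n → label n ≡ abs m →
             Read r (↓ ∷ τ) m t → Read r τ n (ƛ t)
    rd-app : ∀ {τ n m₁ m₂ t₁ t₂} → Path r τ n → label n ≡ app m₁ m₂ →
             Read r (↙ ∷ τ) m₁ t₁ → Read r (↘ ∷ τ) m₂ t₂ →
             Read r τ n (t₁ · t₂)

  SameReadback : Node → Node → Set
  SameReadback r r' = ∃ λ t → Read r [] r t × Read r' [] r' t

  SamePathReadback : Node → Node → Trace → Set
  SamePathReadback r r' τ =
    ∀ n n' → Path r τ n → Path r' τ n' → ∃ λ t → Read r τ n t × Read r' τ n' t

module Submission where

-- A readback ⟦r⟧ = t is a derivation that walks the
-- graph from r and builds t; every path r --τ--> m is walked by it, and the
-- term read at m is exactly the subterm of t at position τ.  Conversely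
-- every position τ of t is reached by a path r --τ-->.  Hence the set of
-- traces of paths from r, and the readbacks along them, depend only on the
-- term ⟦r⟧ — which gives "⇒".  "⇐" is the instance τ = [] of condition (2).
--
-- None of this needs well-formedness of the
-- λ-graph or rootedness: those hypotheses of the theorem are only what makes
-- the readback exist, and here the readback is given.

open import Defs
open import Data.Product using (Σ; _×_; _,_; proj₂)
open import Data.List using ([]; _∷_)
open import Function.Bundles using (_⇔_; mk⇔)
open import Relation.Binary.PropositionalEquality using (_≡_; refl; sym; trans)

-- SubtermAt t τ u : u is the subterm of t at position τ (a trace read from
-- the root of t, with the most recent direction at the head, as for paths).
data SubtermAt {A : Set} (t : Term A) : Trace → Term A → Set where
  at-root : SubtermAt t [] t
  at-body : ∀ {σ u} → SubtermAt t σ (ƛ u) → SubtermAt t (↓ ∷ σ) u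
  at-fun  : ∀ {σ u v} → SubtermAt t σ (u · v) → SubtermAt t (↙ ∷ σ) u
  at-arg  : ∀ {σ u v} → SubtermAt t σ (u · v) → SubtermAt t (↘ ∷ σ) v

module _ {A : Set} (G : Graph A) where
  open Graph G

  path-deterministic : ∀ {n τ m m'} → Path G n τ m → Path G n τ m' → m ≡ m'
  path-deterministic ε ε = refl
  path-deterministic (step↓ p e) (step↓ p' e') with path-deterministic p p'
  ... | refl with trans (sym e) e'
  ...   | refl = refl
  path-deterministic (step↙ p e) (step↙ p' e') with path-deterministic p p'
  ... | refl with trans (sym e) e'
  ...   | refl = refl
  path-deterministic (step↘ p e) (step↘ p' e') with path-deterministic p p'
  ... | refl with trans (sym e) e'
  ...   | refl = refl

  read-abs-inversion : ∀ {r τ m k u} → Read G r τ m u → label m ≡ abs k →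
    Σ (Term A) λ u' → u ≡ ƛ u' × Read G r (↓ ∷ τ) k u'
  read-abs-inversion (rd-abs _ e' rd) e with trans (sym e') e
  ... | refl = _ , refl , rd
  read-abs-inversion (rd-var _ e' _) e with trans (sym e') e
  ... | ()
  read-abs-inversion (rd-fv _ e') e with trans (sym e') e
  ... | ()
  read-abs-inversion (rd-app _ e' _ _) e with trans (sym e') e
  ... | ()

  read-app-inversion : ∀ {r τ m k₁ k₂ u} → Read G r τ m u → label m ≡ app k₁ k₂ →
    Σ (Term A) λ u₁ → Σ (Term A) λ u₂ →
      u ≡ u₁ · u₂ × Read G r (↙ ∷ τ) k₁ u₁ × Read G r (↘ ∷ τ) k₂ u₂
  read-app-inversion (rd-app _ e' rd₁ rd₂) e with trans (sym e') e
  ... | refl = _ , _ , refl , rd₁ , rd₂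
  read-app-inversion (rd-var _ e' _) e with trans (sym e') e
  ... | ()
  read-app-inversion (rd-fv _ e') e with trans (sym e') e
  ... | ()
  read-app-inversion (rd-abs _ e' _) e with trans (sym e') e
  ... | ()

  path⇒subterm : ∀ {r t τ m} → Read G r [] r t → Path G r τ m →
    Σ (Term A) λ u → SubtermAt t τ u × Read G r τ m u
  path⇒subterm rd ε = _ , at-root , rd
  path⇒subterm rd (step↓ p e) with path⇒subterm rd p
  ... | _ , s , rdm with read-abs-inversion rdm e
  ...   | u , refl , rdk = u , at-body s , rdk
  path⇒subterm rd (step↙ p e) with path⇒subterm rd p
  ... | _ , s , rdm with read-app-inversion rdm e
  ...   | u₁ , _ , refl , rd₁ , _ = u₁ , at-fun s , rd₁
  path⇒subterm rd (step↘ p e) with path⇒subterm rd p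
  ... | _ , s , rdm with read-app-inversion rdm e
  ...   | _ , u₂ , refl , _ , rd₂ = u₂ , at-arg s , rd₂

  subterm⇒path : ∀ {r t τ u} → Read G r [] r t → SubtermAt t τ u →
    Σ (Node G) λ m → Path G r τ m × Read G r τ m u
  subterm⇒path rd at-root = _ , ε , rd
  subterm⇒path rd (at-body s) with subterm⇒path rd s
  ... | _ , p , rd-abs _ e rdk = _ , step↓ p e , rdk
  subterm⇒path rd (at-fun s) with subterm⇒path rd s
  ... | _ , p , rd-app _ e rd₁ _ = _ , step↙ p e , rd₁
  subterm⇒path rd (at-arg s) with subterm⇒path rd s
  ... | _ , p , rd-app _ e _ rd₂ = _ , step↘ p e , rd₂

  transfer-path : ∀ {r r' t τ} → Read G r [] r t → Read G r' [] r' t →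
    HasPath G r τ → HasPath G r' τ
  transfer-path rd rd' (_ , p) with path⇒subterm rd p
  ... | _ , s , _ with subterm⇒path rd' s
  ...   | m' , p' , _ = m' , p'

  transfer-readback : ∀ {r r' t} τ → Read G r [] r t → Read G r' [] r' t →
    SamePathReadback G r r' τ
  transfer-readback τ rd rd' n n' p p' with path⇒subterm rd p
  ... | u , s , rdn with subterm⇒path rd' s
  ...   | _ , q , rdn' with path-deterministic q p'
  ...     | refl = u , rdn , rdn'

mainTheorem16 : {A : Set} (G : Graph A) → IsLambdaGraph G →
    (r r' : Node G) → IsRoot G r → IsRoot G r' →
    SameReadback G r r' ⇔
      (∀ (τ : Trace) → (HasPath G r τ ⇔ HasPath G r' τ) × SamePathReadback G r r' τ)
mainTheorem16 G _ r r' _ _ = mk⇔ same⇒traces traces⇒same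
  where
  same⇒traces : SameReadback G r r' →
    ∀ τ → (HasPath G r τ ⇔ HasPath G r' τ) × SamePathReadback G r r' τ
  same⇒traces (_ , rd , rd') τ =
    mk⇔ (transfer-path G rd rd') (transfer-path G rd' rd) , transfer-readback G τ rd rd'

  -- Condition (2) at the empty trace is ⟦r⟧ = ⟦r'⟧ itself.
  traces⇒same : (∀ τ → (HasPath G r τ ⇔ HasPath G r' τ) × SamePathReadback G r r' τ) →
    SameReadback G r r'
  traces⇒same h = proj₂ (h []) r r' ε ε
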